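{- Let $M$ be a finite LTS, $B\subseteq\mathit{Act}$, and $\phi_{off}$ a mapping from $\overline{B}$ to closed modal $\mu$-calculus formulae such that $P_S$ is feasible and a state is $B$-locked if, and only if, it satisfies $\phi_{off}(b)$ for all $b\in\overline{B}$. Then every path that satisfies $P_S$ is $B$-progressing.
   Context: LTS $M=(S,s_{init},\mathit{Act},\mathit{Trans})$ with $S,\mathit{Act}$ finite. Paths: alternating sequences $s_0t_1s_1\dots$ starting in a state, infinite or ending in a state (final state), consecutive. An action occurs on a path if a transition on it carries that label. An action is enabled in $s$ if a transition with that label leaves $s$. $\overline{B}=\mathit{Act}\setminus B$. A state is $B$-locked if all actions enabled in it are in $B$; a path is $B$-progressing if infinite or its final state is $B$-locked. A path $\pi$ satisfies $P_S$ iff for every $a\in\overline{B}$, $a$ occurs infinitely often on $\pi$ or $\pi$ has a suffix every state of which satisfies $\phi_{off}(a)$. A path predicate is feasible if for every LTS, every finite path can be extended to a path of that LTS satisfying it. -}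

module Defs where

open import Data.Nat using (ℕ; zero; suc; _≤_; _<_)
open import Data.Fin using (Fin; zero; suc)
open import Data.Fin.Subset using (Subset; _∈_; _∉_)
open import Data.Bool using (Bool; true; false; _∧_; _∨_)
open import Data.Maybe using (Maybe; just; nothing)
open import Data.Unit using (⊤)
open import Data.Empty using (⊥)
open import Data.Product using (Σ; ∃; _×_; _,_)
open import Data.Sum using (_⊎_)
open import Function using (_∘_)
open import Relation.Binary.PropositionalEquality using (_≡_)

record LTS (k : ℕ) : Set where
  field
    n     : ℕ
    sinit : Fin n
    trans : Fin n → Fin k → Fin n → Bool

  State : Set
  State = Fin n

open LTS public

module _ {k : ℕ} (M : LTS k) where

  Enabled : Fin k → State M → Set
  Enabled a s = Σ (State M) λ s' → trans M s a s' ≡ true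

  BLocked : Subset k → State M → Set
  BLocked B s = ∀ a → Enabled a s → a ∈ B

-- A path has a length `len` (nothing = infinite, just m = finite
-- with m transitions, so states s_0..s_m).  st i is the i-th state, act i
-- the label of the i-th transition t_{i+1} (from st i to st (suc i)).
-- Values of st / act outside the index range are irrelevant.

SIdx : Maybe ℕ → ℕ → Set
SIdx nothing  i = ⊤
SIdx (just m) i = i ≤ m

TIdx : Maybe ℕ → ℕ → Set
TIdx nothing  i = ⊤
TIdx (just m) i = i < m

record Path {k : ℕ} (M : LTS k) : Set where
  field
    len   : Maybe ℕ
    st    : ℕ → State M
    act   : ℕ → Fin k
    valid : ∀ i → TIdx len i → trans M (st i) (act i) (st (suc i)) ≡ true

open Path public

module _ {k : ℕ} {M : LTS k} where

  IsFinite : Path M → Set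
  IsFinite π = Σ ℕ λ m → len π ≡ just m

  Extends : Path M → Path M → Set
  Extends π π' =
    (∀ i → SIdx (len π) i → SIdx (len π') i) ×
    (∀ i → SIdx (len π) i → st π i ≡ st π' i) ×
    (∀ i → TIdx (len π) i → act π i ≡ act π' i)

  InfOften : Fin k → Path M → Set
  InfOften a π = ∀ i → Σ ℕ λ j → i ≤ j × TIdx (len π) j × act π j ≡ a

  SuffixAll : (State M → Set) → Path M → Set
  SuffixAll P π = Σ ℕ λ i → SIdx (len π) i ×
                   (∀ j → i ≤ j → SIdx (len π) j → P (st π j))

  Progressing : Subset k → Path M → Set
  Progressing B π = len π ≡ nothing ⊎
                    (Σ ℕ λ m → len π ≡ just m × BLocked M B (st π m))

-- Modal μ-calculus (positive normal form), formulas with m free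
-- fixpoint variables (de Bruijn); closed formulas are Formula k 0.

data Formula (k : ℕ) : ℕ → Set where
  var     : ∀ {m} → Fin m → Formula k m
  tt ff   : ∀ {m} → Formula k m
  _and_   : ∀ {m} → Formula k m → Formula k m → Formula k m
  _or_    : ∀ {m} → Formula k m → Formula k m → Formula k m
  ⟨_⟩_    : ∀ {m} → Fin k → Formula k m → Formula k m
  [_]_    : ∀ {m} → Fin k → Formula k m → Formula k m
  μ_      : ∀ {m} → Formula k (suc m) → Formula k m
  ν_      : ∀ {m} → Formula k (suc m) → Formula k m

anyFin : ∀ {n} → (Fin n → Bool) → Bool
anyFin {zero}  f = false
anyFin {suc n} f = f zero ∨ anyFin (f ∘ suc)

allFin : ∀ {n} → (Fin n → Bool) → Bool
allFin {zero}  f = true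
allFin {suc n} f = f zero ∧ allFin (f ∘ suc)

iter : ∀ {A : Set} → ℕ → (A → A) → A → A
iter zero    f x = x
iter (suc i) f x = f (iter i f x)

extend : ∀ {A : Set} {m} → A → (Fin m → A) → Fin (suc m) → A
extend x ρ zero    = x
extend x ρ (suc i) = ρ i

module _ {k : ℕ} (M : LTS k) where

  StSet : Set
  StSet = State M → Bool

  -- On the finite lattice of state sets (height n)
  -- the least / greatest fixpoint of a monotone map is reached after
  -- n+1 iterations from the empty / full set (Knaster–Tarski / Kleene).
  ⟦_⟧ : ∀ {m} → Formula k m → (Fin m → StSet) → StSet
  ⟦ var x ⟧   ρ = ρ x
  ⟦ tt ⟧      ρ = λ _ → true
  ⟦ ff ⟧      ρ = λ _ → false
  ⟦ φ and ψ ⟧ ρ = λ s → ⟦ φ ⟧ ρ s ∧ ⟦ ψ ⟧ ρ s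
  ⟦ φ or ψ ⟧  ρ = λ s → ⟦ φ ⟧ ρ s ∨ ⟦ ψ ⟧ ρ s
  ⟦ ⟨ a ⟩ φ ⟧ ρ = λ s → anyFin (λ s' → trans M s a s' ∧ ⟦ φ ⟧ ρ s')
  ⟦ [ a ] φ ⟧ ρ = λ s → allFin (λ s' → Data.Bool.if trans M s a s' then ⟦ φ ⟧ ρ s' else true)
  ⟦ μ φ ⟧     ρ = iter (suc (n M)) (λ X → ⟦ φ ⟧ (extend X ρ)) (λ _ → false)
  ⟦ ν φ ⟧     ρ = iter (suc (n M)) (λ X → ⟦ φ ⟧ (extend X ρ)) (λ _ → true)

  emptyEnv : Fin 0 → StSet
  emptyEnv ()

  _⊨_ : State M → Formula k 0 → Set
  s ⊨ φ = ⟦ φ ⟧ emptyEnv s ≡ true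

OffMap : (k : ℕ) → Subset k → Set
OffMap k B = (a : Fin k) → a ∉ B → Formula k 0

PS : ∀ {k} (M : LTS k) (B : Subset k) → OffMap k B → Path M → Set
PS M B φoff π = ∀ a → (a∉B : a ∉ B) →
  InfOften a π ⊎ SuffixAll (λ s → _⊨_ M s (φoff a a∉B)) π

Feasible : ∀ {k} (B : Subset k) → OffMap k B → Set
Feasible {k} B φoff = ∀ (M : LTS k) (π : Path M) → IsFinite π →
  Σ (Path M) λ π' → Extends π π' × PS M B φoff π'

{-# OPTIONS --safe #-}
-- On a finite path no action occurs infinitely often, so P_S forces each
-- φ_off(b) on a suffix, in particular at the final state; by the assumed
-- characterisation that state is B-locked.
module Submission where

open import Defs
open import Data.Nat using (ℕ)
open import Data.Nat.Properties using (≤-refl; ≤⇒≯)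
open import Data.Fin using (Fin)
open import Data.Fin.Subset using (Subset; _∉_)
open import Data.Maybe using (just; nothing)
open import Data.Product using (_,_)
open import Data.Sum using (inj₁; inj₂)
open import Function.Bundles using (_⇔_; Equivalence)
open import Relation.Nullary using (¬_; contradiction)
open import Relation.Binary.PropositionalEquality using (_≡_; refl)

module _ {k : ℕ} {M : LTS k} {π : Path M} {m : ℕ} (finite : len π ≡ just m) where

  ¬InfOften-finite : ∀ {a} → ¬ InfOften a π
  ¬InfOften-finite infOften with infOften m
  ... | j , m≤j , j<len , _ rewrite finite = ≤⇒≯ m≤j j<len

  SuffixAll-last : ∀ {P : State M → Set} → SuffixAll P π → P (st π m)
  SuffixAll-last (i , i≤len , all) rewrite finite = all m i≤len ≤-refl

  PS-last : ∀ {B : Subset k} (φoff : OffMap k B) → PS M B φoff π →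
    ∀ b (b∉B : b ∉ B) → _⊨_ M (st π m) (φoff b b∉B)
  PS-last φoff ps b b∉B with ps b b∉B
  ... | inj₁ infOften = contradiction infOften ¬InfOften-finite
  ... | inj₂ suffix   = SuffixAll-last {P = λ s → _⊨_ M s (φoff b b∉B)} suffix

Progressing-from-last : ∀ {k} {M : LTS k} (B : Subset k) (π : Path M) →
  (∀ {m} → len π ≡ just m → BLocked M B (st π m)) → Progressing B π
Progressing-from-last B π lastLocked with len π | lastLocked
... | nothing | _      = inj₁ refl
... | just m  | locked = inj₂ (m , refl , locked refl)

proposition57 : ∀ {k : ℕ} (M : LTS k) (B : Subset k) (φoff : OffMap k B) →
    Feasible B φoff →
    (∀ (s : State M) → BLocked M B s ⇔ (∀ (b : Fin k) (b∉B : b ∉ B) → _⊨_ M s (φoff b b∉B))) →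
    ∀ (π : Path M) → PS M B φoff π → Progressing B π
proposition57 M B φoff _ lockedIff π ps =
  Progressing-from-last B π λ finite →
    Equivalence.from (lockedIff _) (PS-last {π = π} finite φoff ps)
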